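{- Let $\mathcal G$ be a hereditary class of graphs. If $G\in\mathcal G^\&$ and $v\in V(G)$, then $G[N_G(v)]\in\mathcal G^*$.
   Context: A class is hereditary if it contains every graph isomorphic to an induced subgraph of any of its members. $N_G(v)$ is the set of neighbors of $v$ and $G[S]$ the induced subgraph on $S$. For graphs $G_1,G_2$ with $|V(G_1)|,|V(G_2)|\ge 3$, $V(G_1)\cap V(G_2)=\emptyset$, and $v_1\in V(G_1)$, $v_2\in V(G_2)$, the $1$-join of $(G_1,v_1)$ and $(G_2,v_2)$ is obtained from the disjoint union of $G_1$ and $G_2$ by deleting $v_1,v_2$ and adding all edges between every neighbor of $v_1$ in $G_1$ and every neighbor of $v_2$ in $G_2$. $\mathcal G^\&$ is the closure of $\mathcal G$ under disjoint union and $1$-join. For graphs $G_1,G_2$ on disjoint vertex sets and $v\in V(G_1)$, the graph obtained by substituting $G_2$ for $v$ in $G_1$ has vertex set $(V(G_1)\setminus\{v\})\cup V(G_2)$ and edge set $E(G_1\setminus v)\cup E(G_2)\cup\{xy: x\in N_{G_1}(v), y\in V(G_2)\}$. $\mathcal G^*$ is the closure of $\mathcal G$ under disjoint union and substitution. -}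

module Defs where

open import Data.Bool using (Bool; true; false; not; _∧_)
open import Data.Nat using (ℕ; _≤_; _+_)
open import Data.Product using (Σ)
open import Data.Fin using (Fin; splitAt; _↑ˡ_; _↑ʳ_; _≟_)
open import Data.Sum using (_⊎_; inj₁; inj₂)
open import Data.List using (List; length; filterᵇ; allFin; lookup)
open import Relation.Nullary.Decidable using (⌊_⌋)
open import Relation.Binary.PropositionalEquality using (_≡_; refl)

record Graph : Set where
  field
    n   : ℕ
    adj : Fin n → Fin n → Bool
    sym : ∀ i j → adj i j ≡ adj j i
    irr : ∀ i → adj i i ≡ false
open Graph public

V : Graph → Set
V G = Fin (n G)

Class : Set₁
Class = Graph → Set

record _≅_ (G H : Graph) : Set where
  field
    to       : V G → V H
    from     : V H → V G
    from-to  : ∀ x → from (to x) ≡ x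
    to-from  : ∀ y → to (from y) ≡ y
    adj-pres : ∀ x y → adj G x y ≡ adj H (to x) (to y)

-- Induced subgraph G[S] for S ⊆ V(G) given by its characteristic function;
-- the vertices of S are relabelled 0,1,…,|S|-1 in increasing order.
members : (G : Graph) → (V G → Bool) → List (V G)
members G S = filterᵇ S (allFin (n G))

induced : (G : Graph) → (V G → Bool) → Graph
induced G S = record
  { n   = length (members G S)
  ; adj = λ i j → adj G (lookup (members G S) i) (lookup (members G S) j)
  ; sym = λ i j → sym G (lookup (members G S) i) (lookup (members G S) j)
  ; irr = λ i → irr G (lookup (members G S) i)
  }

N : (G : Graph) → V G → V G → Bool
N G v = adj G v

IsInducedSubgraphOf : Graph → Graph → Set
IsInducedSubgraphOf H G = Σ (V G → Bool) (λ S → H ≅ induced G S)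

Hereditary : Class → Set
Hereditary 𝒢 = ∀ {G H} → 𝒢 G → IsInducedSubgraphOf H G → 𝒢 H

module _ (G₁ G₂ : Graph) (c : V G₁ → V G₂ → Bool) where
  private
    a : V G₁ ⊎ V G₂ → V G₁ ⊎ V G₂ → Bool
    a (inj₁ x) (inj₁ y) = adj G₁ x y
    a (inj₂ x) (inj₂ y) = adj G₂ x y
    a (inj₁ x) (inj₂ y) = c x y
    a (inj₂ x) (inj₁ y) = c y x

    a-sym : ∀ p q → a p q ≡ a q p
    a-sym (inj₁ x) (inj₁ y) = sym G₁ x y
    a-sym (inj₂ x) (inj₂ y) = sym G₂ x y
    a-sym (inj₁ x) (inj₂ y) = refl
    a-sym (inj₂ x) (inj₁ y) = refl

    a-irr : ∀ p → a p p ≡ false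
    a-irr (inj₁ x) = irr G₁ x
    a-irr (inj₂ x) = irr G₂ x

  glue : Graph
  glue = record
    { n   = n G₁ + n G₂
    ; adj = λ i j → a (splitAt (n G₁) i) (splitAt (n G₁) j)
    ; sym = λ i j → a-sym (splitAt (n G₁) i) (splitAt (n G₁) j)
    ; irr = λ i → a-irr (splitAt (n G₁) i)
    }

_⊕_ : Graph → Graph → Graph
G₁ ⊕ G₂ = glue G₁ G₂ (λ _ _ → false)

-- Substituting G₂ for v in G₁: glue with every neighbour of v joined to all
-- of V(G₂), then delete (the copy of) v.
substitute : (G₁ : Graph) → V G₁ → Graph → Graph
substitute G₁ v G₂ =
  induced (glue G₁ G₂ (λ x _ → adj G₁ v x))
          (λ i → not ⌊ i ≟ (v ↑ˡ n G₂) ⌋)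

-- 1-join of (G₁,v₁) and (G₂,v₂): join every neighbour of v₁ to every
-- neighbour of v₂, then delete v₁ and v₂.
oneJoin : (G₁ : Graph) → V G₁ → (G₂ : Graph) → V G₂ → Graph
oneJoin G₁ v₁ G₂ v₂ =
  induced (glue G₁ G₂ (λ x y → adj G₁ v₁ x ∧ adj G₂ v₂ y))
          (λ i → not ⌊ i ≟ (v₁ ↑ˡ n G₂) ⌋ ∧ not ⌊ i ≟ (n G₁ ↑ʳ v₂) ⌋)

-- Closures (taken up to isomorphism, since graphs here have concrete
-- vertex sets Fin n).

data Amp (𝒢 : Class) : Class where
  base  : ∀ {G} → 𝒢 G → Amp 𝒢 G
  iso   : ∀ {G H} → Amp 𝒢 G → G ≅ H → Amp 𝒢 H
  union : ∀ {G₁ G₂} → Amp 𝒢 G₁ → Amp 𝒢 G₂ → Amp 𝒢 (G₁ ⊕ G₂)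
  join  : ∀ {G₁ G₂} → Amp 𝒢 G₁ → Amp 𝒢 G₂ → 3 ≤ n G₁ → 3 ≤ n G₂ →
          (v₁ : V G₁) (v₂ : V G₂) → Amp 𝒢 (oneJoin G₁ v₁ G₂ v₂)

data Star (𝒢 : Class) : Class where
  base  : ∀ {G} → 𝒢 G → Star 𝒢 G
  iso   : ∀ {G H} → Star 𝒢 G → G ≅ H → Star 𝒢 H
  union : ∀ {G₁ G₂} → Star 𝒢 G₁ → Star 𝒢 G₂ → Star 𝒢 (G₁ ⊕ G₂)
  subst : ∀ {G₁ G₂} → Star 𝒢 G₁ → Star 𝒢 G₂ → (v : V G₁) →
          Star 𝒢 (substitute G₁ v G₂)

module Submission where

-- Call G "locally in 𝒢^*" when every neighbourhood graph G[N_G(v)] lies in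
-- 𝒢^*.  We show by induction on the derivation of G ∈ 𝒢^& that G is locally
-- in 𝒢^*.  Members of 𝒢 are (heredity), and the property survives
-- isomorphism, disjoint union and 1-join.  For a 1-join of (G₁,v₁) and
-- (G₂,v₂), take a vertex a of G₁ (the G₂ side follows by symmetry): if a is
-- not adjacent to v₁ its neighbourhood is exactly G₁[N(a)]; if it is, the
-- neighbourhood is G₁[N(a)] with v₁ replaced by G₂[N(v₂)], i.e. a
-- substitution of two graphs already in 𝒢^*.
--
-- Every such identification of neighbourhoods is an isomorphism of induced
-- subgraphs, and all of them come from a single transfer principle
-- (induced-≅): an adjacency-preserving injection that carries one vertex set
-- exactly onto another induces an isomorphism of the induced subgraphs.

open import Data.Bool using (Bool; true; false; not; _∧_)
open import Data.Bool.Properties using (T-≡; ∧-identityʳ; ∧-zeroʳ; ∧-comm; ∧-conicalˡ; ∧-conicalʳ)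
open import Data.Empty using (⊥-elim)
open import Data.Fin using (Fin; zero; suc; splitAt; _↑ˡ_; _↑ʳ_; _≟_) renaming (join to unsplit)
open import Data.Fin.Properties using (splitAt-↑ˡ; splitAt-↑ʳ; splitAt⁻¹-↑ˡ; splitAt⁻¹-↑ʳ; splitAt-join; join-splitAt; ↑ˡ-injective; ↑ʳ-injective)
open import Data.List using (List; _∷_; lookup; allFin)
open import Data.List.Membership.Propositional using (_∈_)
open import Data.List.Membership.Propositional.Properties using (∈-allFin; ∈-lookup; ∈-filter⁺; ∈-filter⁻)
import Data.List.Relation.Unary.All as All
import Data.List.Relation.Unary.Any as Any
open import Data.List.Relation.Unary.Any.Properties using (lookup-index)
open import Data.List.Relation.Unary.AllPairs using (_∷_)
open import Data.List.Relation.Unary.Unique.Propositional using (Unique)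
open import Data.List.Relation.Unary.Unique.Propositional.Properties using (filter⁺; allFin⁺)
open import Data.Nat using (ℕ; _+_)
open import Data.Product using (Σ; _,_; proj₁; proj₂)
open import Data.Sum using (_⊎_; inj₁; inj₂)
import Data.Sum as Sum
open import Data.Sum.Properties using (inj₁-injective; inj₂-injective; swap-involutive)
open import Function using (_∘_; Equivalence)
open import Relation.Nullary using (yes; no)
open import Relation.Nullary.Decidable using (⌊_⌋)
open import Relation.Nullary.Decidable.Core using (T?)
open import Relation.Binary.PropositionalEquality
  using (_≡_; _≢_; refl; sym; trans; cong; cong₂; module ≡-Reasoning)
  renaming (subst to ≡-subst)
open import Defs renaming (sym to adj-sym; subst to star-subst)

open ≡-Reasoning

≟-injective : ∀ {m k} (f : Fin m → Fin k) → (∀ {x y} → f x ≡ f y → x ≡ y) →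
              ∀ x y → ⌊ f x ≟ f y ⌋ ≡ ⌊ x ≟ y ⌋
≟-injective f f-inj x y with f x ≟ f y | x ≟ y
... | yes _  | yes _    = refl
... | no _   | no _     = refl
... | yes fe | no x≢y   = ⊥-elim (x≢y (f-inj fe))
... | no fne | yes refl = ⊥-elim (fne refl)

≟-distinct : ∀ {m} {x y : Fin m} → x ≢ y → ⌊ x ≟ y ⌋ ≡ false
≟-distinct {x = x} {y} x≢y with x ≟ y
... | yes x≡y = ⊥-elim (x≢y x≡y)
... | no _    = refl

neighbour-distinct : (G : Graph) {x y : V G} → adj G x y ≡ true → y ≢ x
neighbour-distinct G {x} xy refl with trans (sym (irr G x)) xy
... | ()

member∈S : (G : Graph) (S : V G → Bool) (i : V (induced G S)) →
           S (lookup (members G S) i) ≡ true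
member∈S G S i =
  Equivalence.to T-≡ (proj₂ (∈-filter⁻ (T? ∘ S) {xs = allFin (n G)} (∈-lookup i)))

member-index : (G : Graph) (S : V G → Bool) (x : V G) → S x ≡ true →
               Σ (V (induced G S)) λ i → lookup (members G S) i ≡ x
member-index G S x Sx = Any.index x∈S , sym (lookup-index x∈S)
  where
  x∈S : x ∈ members G S
  x∈S = ∈-filter⁺ (T? ∘ S) (∈-allFin x) (Equivalence.from T-≡ Sx)

lookup-injective : {A : Set} (xs : List A) → Unique xs →
                   ∀ i j → lookup xs i ≡ lookup xs j → i ≡ j
lookup-injective (x ∷ xs) (_ ∷ _)        zero    zero    _ = refl
lookup-injective (x ∷ xs) (x∉xs ∷ _)     zero    (suc j) e = ⊥-elim (All.lookup x∉xs (∈-lookup j) e)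
lookup-injective (x ∷ xs) (x∉xs ∷ _)     (suc i) zero    e = ⊥-elim (All.lookup x∉xs (∈-lookup i) (sym e))
lookup-injective (x ∷ xs) (_ ∷ xs-uniq)  (suc i) (suc j) e = cong suc (lookup-injective xs xs-uniq i j e)

members-injective : (G : Graph) (S : V G → Bool) {i j : V (induced G S)} →
                    lookup (members G S) i ≡ lookup (members G S) j → i ≡ j
members-injective G S =
  lookup-injective (members G S) (filter⁺ (T? ∘ S) (allFin⁺ (n G))) _ _

-- Embeddings and the transfer principle for induced subgraphs.

record Embedding (G H : Graph) : Set where
  field
    map       : V G → V H
    injective : ∀ {x y} → map x ≡ map y → x ≡ y
    adj-pres  : ∀ x y → adj G x y ≡ adj H (map x) (map y)

-- An embedding carrying S ⊆ V(G) exactly onto T ⊆ V(H) gives G[S] ≅ H[T]: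
-- a vertex of G[S] is sent to the position of the image of its member.
module _ {G H : Graph} (e : Embedding G H) {S : V G → Bool} {T : V H → Bool}
         (onto-set : ∀ x → T (Embedding.map e x) ≡ S x)
         (covers   : ∀ y → T y ≡ true → Σ (V G) λ x → Embedding.map e x ≡ y) where
  open Embedding e

  private
    LS = members G S
    LT = members H T

    to-member : (i : V (induced G S)) →
                Σ (V (induced H T)) λ j → lookup LT j ≡ map (lookup LS i)
    to-member i = member-index H T (map (lookup LS i)) (trans (onto-set _) (member∈S G S i))

    from-member : (j : V (induced H T)) →
                  Σ (V (induced G S)) λ i → map (lookup LS i) ≡ lookup LT j
    from-member j with covers (lookup LT j) (member∈S H T j)
    ... | x , x↦y with member-index G S x (trans (sym (onto-set x)) (trans (cong T x↦y) (member∈S H T j)))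
    ...   | i , i↦x = i , trans (cong map i↦x) x↦y

  induced-≅ : induced G S ≅ induced H T
  induced-≅ = record
    { to       = λ i → proj₁ (to-member i)
    ; from     = λ j → proj₁ (from-member j)
    ; from-to  = λ i → members-injective G S (injective
                   (trans (proj₂ (from-member (proj₁ (to-member i)))) (proj₂ (to-member i))))
    ; to-from  = λ j → members-injective H T
                   (trans (proj₂ (to-member (proj₁ (from-member j)))) (proj₂ (from-member j)))
    ; adj-pres = λ i j → trans (adj-pres (lookup LS i) (lookup LS j))
                   (sym (cong₂ (adj H) (proj₂ (to-member i)) (proj₂ (to-member j))))
    }

members-embedding : (G : Graph) (S : V G → Bool) → Embedding (induced G S) G
members-embedding G S = record
  { map = lookup (members G S) ; injective = members-injective G S ; adj-pres = λ _ _ → refl }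

iso-embedding : ∀ {G H} → G ≅ H → Embedding G H
iso-embedding e = record
  { map       = to
  ; injective = λ {x} {y} tx≡ty → trans (sym (from-to x)) (trans (cong from tx≡ty) (from-to y))
  ; adj-pres  = adj-pres
  }
  where open _≅_ e

refl≅ : ∀ {G} → G ≅ G
refl≅ = record
  { to = λ x → x ; from = λ x → x ; from-to = λ _ → refl ; to-from = λ _ → refl ; adj-pres = λ _ _ → refl }

sym≅ : ∀ {G H} → G ≅ H → H ≅ G
sym≅ {G} {H} e = record
  { to = from ; from = to ; from-to = to-from ; to-from = from-to
  ; adj-pres = λ x y → trans (cong₂ (adj H) (sym (to-from x)) (sym (to-from y)))
                             (sym (adj-pres (from x) (from y)))
  }
  where open _≅_ e

nbhd-≅ : ∀ {G H} (e : G ≅ H) (u : V G) → induced G (N G u) ≅ induced H (N H (_≅_.to e u))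
nbhd-≅ {G} {H} e u =
  induced-≅ (iso-embedding e) (λ x → sym (adj-pres u x)) (λ y _ → from y , to-from y)
  where open _≅_ e

induced-nbhd-≅ : (G : Graph) (S : V G → Bool) (w : V (induced G S)) →
                 induced G (λ x → S x ∧ adj G (lookup (members G S) w) x)
                   ≅ induced (induced G S) (N (induced G S) w)
induced-nbhd-≅ G S w = sym≅ (induced-≅ (members-embedding G S)
  (λ i → cong (_∧ adj G (lookup (members G S) w) (lookup (members G S) i)) (member∈S G S i))
  (λ y Sy∧wy → member-index G S y (∧-conicalˡ _ _ Sy∧wy)))

-- Glued graphs.

data Side (m k : ℕ) : Fin (m + k) → Set where
  left  : (x : Fin m) → Side m k (x ↑ˡ k)
  right : (y : Fin k) → Side m k (m ↑ʳ y)

side : ∀ m k (i : Fin (m + k)) → Side m k i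
side m k i with splitAt m i in eq
... | inj₁ x = ≡-subst (Side m k) (splitAt⁻¹-↑ˡ eq) (left x)
... | inj₂ y = ≡-subst (Side m k) (splitAt⁻¹-↑ʳ eq) (right y)

↑ˡ≢↑ʳ : ∀ {m k} (x : Fin m) (y : Fin k) → x ↑ˡ k ≢ m ↑ʳ y
↑ˡ≢↑ʳ {m} {k} x y e with trans (sym (splitAt-↑ˡ m x k)) (trans (cong (splitAt m) e) (splitAt-↑ʳ m k y))
... | ()

splitAt-injective : ∀ m {k} {i j : Fin (m + k)} → splitAt m i ≡ splitAt m j → i ≡ j
splitAt-injective m {k} {i} {j} same = begin
  i                      ≡⟨ sym (join-splitAt m k i) ⟩
  unsplit m k (splitAt m i) ≡⟨ cong (unsplit m k) same ⟩
  unsplit m k (splitAt m j) ≡⟨ join-splitAt m k j ⟩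
  j                      ∎

module GlueAdj (G₁ G₂ : Graph) (c : V G₁ → V G₂ → Bool) where
  adj-ˡˡ : ∀ x y → adj (glue G₁ G₂ c) (x ↑ˡ n G₂) (y ↑ˡ n G₂) ≡ adj G₁ x y
  adj-ˡˡ x y rewrite splitAt-↑ˡ (n G₁) x (n G₂) | splitAt-↑ˡ (n G₁) y (n G₂) = refl

  adj-ˡʳ : ∀ x y → adj (glue G₁ G₂ c) (x ↑ˡ n G₂) (n G₁ ↑ʳ y) ≡ c x y
  adj-ˡʳ x y rewrite splitAt-↑ˡ (n G₁) x (n G₂) | splitAt-↑ʳ (n G₁) (n G₂) y = refl

left-embedding : (G₁ G₂ : Graph) (c : V G₁ → V G₂ → Bool) → Embedding G₁ (glue G₁ G₂ c)
left-embedding G₁ G₂ c = record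
  { map = _↑ˡ n G₂ ; injective = ↑ˡ-injective (n G₂) _ _ ; adj-pres = λ x y → sym (adj-ˡˡ x y) }
  where open GlueAdj G₁ G₂ c

glue-left-nbhd : (G₁ G₂ : Graph) (c : V G₁ → V G₂ → Bool) (a : V G₁)
                 (T : V (glue G₁ G₂ c) → Bool) →
                 (∀ x → T (x ↑ˡ n G₂) ≡ adj G₁ a x) → (∀ y → T (n G₁ ↑ʳ y) ≡ false) →
                 induced G₁ (N G₁ a) ≅ induced (glue G₁ G₂ c) T
glue-left-nbhd G₁ G₂ c a T on-left off-right =
  induced-≅ (left-embedding G₁ G₂ c) on-left covers
  where
  covers : ∀ z → T z ≡ true → Σ (V G₁) λ x → x ↑ˡ n G₂ ≡ z
  covers z Tz with side (n G₁) (n G₂) z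
  ... | left x  = x , refl
  ... | right y with trans (sym (off-right y)) Tz
  ...   | ()

module _ {G₁ G₂ H₁ H₂ : Graph} (e₁ : Embedding G₁ H₁) (e₂ : Embedding G₂ H₂)
         {c : V G₁ → V G₂ → Bool} {d : V H₁ → V H₂ → Bool}
         (cross : ∀ x y → c x y ≡ d (Embedding.map e₁ x) (Embedding.map e₂ y)) where
  private
    module E₁ = Embedding e₁
    module E₂ = Embedding e₂

    map-⊎ : V G₁ ⊎ V G₂ → V H₁ ⊎ V H₂
    map-⊎ = Sum.map E₁.map E₂.map

    map-⊎-injective : ∀ {p q} → map-⊎ p ≡ map-⊎ q → p ≡ q
    map-⊎-injective {inj₁ x} {inj₁ y} e = cong inj₁ (E₁.injective (inj₁-injective e))
    map-⊎-injective {inj₂ x} {inj₂ y} e = cong inj₂ (E₂.injective (inj₂-injective e))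

  glue-map : V (glue G₁ G₂ c) → V (glue H₁ H₂ d)
  glue-map i = unsplit (n H₁) (n H₂) (map-⊎ (splitAt (n G₁) i))

  private
    split-glue-map : ∀ i → splitAt (n H₁) (glue-map i) ≡ map-⊎ (splitAt (n G₁) i)
    split-glue-map i = splitAt-join (n H₁) (n H₂) _

    adj-pres : ∀ i j → adj (glue G₁ G₂ c) i j ≡ adj (glue H₁ H₂ d) (glue-map i) (glue-map j)
    adj-pres i j rewrite split-glue-map i | split-glue-map j
      with splitAt (n G₁) i | splitAt (n G₁) j
    ... | inj₁ x | inj₁ y = E₁.adj-pres x y
    ... | inj₁ x | inj₂ y = cross x y
    ... | inj₂ x | inj₁ y = cross y x
    ... | inj₂ x | inj₂ y = E₂.adj-pres x y

  glue-embedding : Embedding (glue G₁ G₂ c) (glue H₁ H₂ d)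
  glue-embedding = record
    { map       = glue-map
    ; injective = λ {i} {j} same → splitAt-injective (n G₁) (map-⊎-injective (begin
        map-⊎ (splitAt (n G₁) i) ≡⟨ sym (split-glue-map i) ⟩
        splitAt (n H₁) (glue-map i) ≡⟨ cong (splitAt (n H₁)) same ⟩
        splitAt (n H₁) (glue-map j) ≡⟨ split-glue-map j ⟩
        map-⊎ (splitAt (n G₁) j) ∎))
    ; adj-pres  = adj-pres
    }

  glue-map-ˡ : ∀ x → glue-map (x ↑ˡ n G₂) ≡ E₁.map x ↑ˡ n H₂
  glue-map-ˡ x = cong (unsplit (n H₁) (n H₂) ∘ map-⊎) (splitAt-↑ˡ (n G₁) x (n G₂))

  glue-map-ʳ : ∀ y → glue-map (n G₁ ↑ʳ y) ≡ n H₁ ↑ʳ E₂.map y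
  glue-map-ʳ y = cong (unsplit (n H₁) (n H₂) ∘ map-⊎) (splitAt-↑ʳ (n G₁) (n G₂) y)

swap : ∀ m k → Fin (m + k) → Fin (k + m)
swap m k i = unsplit k m (Sum.swap (splitAt m i))

swap-ˡ : ∀ m k (x : Fin m) → swap m k (x ↑ˡ k) ≡ k ↑ʳ x
swap-ˡ m k x = cong (unsplit k m ∘ Sum.swap) (splitAt-↑ˡ m x k)

swap-ʳ : ∀ m k (y : Fin k) → swap m k (m ↑ʳ y) ≡ y ↑ˡ m
swap-ʳ m k y = cong (unsplit k m ∘ Sum.swap) (splitAt-↑ʳ m k y)

swap-involutive′ : ∀ m k (i : Fin (m + k)) → swap k m (swap m k i) ≡ i
swap-involutive′ m k i = begin
  unsplit m k (Sum.swap (splitAt k (unsplit k m (Sum.swap (splitAt m i)))))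
    ≡⟨ cong (unsplit m k ∘ Sum.swap) (splitAt-join k m (Sum.swap (splitAt m i))) ⟩
  unsplit m k (Sum.swap (Sum.swap (splitAt m i)))
    ≡⟨ cong (unsplit m k) (swap-involutive (splitAt m i)) ⟩
  unsplit m k (splitAt m i)
    ≡⟨ join-splitAt m k i ⟩
  i ∎

glue-swap : (G₁ G₂ : Graph) {c : V G₁ → V G₂ → Bool} {c′ : V G₂ → V G₁ → Bool} →
            (∀ y x → c′ y x ≡ c x y) → glue G₂ G₁ c′ ≅ glue G₁ G₂ c
glue-swap G₁ G₂ {c} {c′} transposed = record
  { to       = swap (n G₂) (n G₁)
  ; from     = swap (n G₁) (n G₂)
  ; from-to  = swap-involutive′ (n G₂) (n G₁)
  ; to-from  = swap-involutive′ (n G₁) (n G₂)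
  ; adj-pres = adj-pres
  }
  where
  adj-pres : ∀ i j → adj (glue G₂ G₁ c′) i j
                     ≡ adj (glue G₁ G₂ c) (swap (n G₂) (n G₁) i) (swap (n G₂) (n G₁) j)
  adj-pres i j rewrite splitAt-join (n G₁) (n G₂) (Sum.swap (splitAt (n G₂) i))
                     | splitAt-join (n G₁) (n G₂) (Sum.swap (splitAt (n G₂) j))
    with splitAt (n G₂) i | splitAt (n G₂) j
  ... | inj₁ y | inj₁ y′ = refl
  ... | inj₁ y | inj₂ x  = transposed y x
  ... | inj₂ x | inj₁ y  = transposed y x
  ... | inj₂ x | inj₂ x′ = refl

-- The closure steps.

module Closure (𝒢 : Class) where

  LocallyStar : Graph → Set
  LocallyStar G = ∀ v → Star 𝒢 (induced G (N G v))

  nbhd-transport : ∀ {G H} (e : G ≅ H) {u : V G} {v : V H} → _≅_.to e u ≡ v →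
                   Star 𝒢 (induced G (N G u)) → Star 𝒢 (induced H (N H v))
  nbhd-transport e {u} refl s = iso s (nbhd-≅ e u)

  base-local : Hereditary 𝒢 → ∀ {G} → 𝒢 G → LocallyStar G
  base-local hereditary {G} g v = base (hereditary g (N G v , refl≅))

  iso-local : ∀ {G H} → LocallyStar G → G ≅ H → LocallyStar H
  iso-local local e v = nbhd-transport e (to-from v) (local (from v))
    where open _≅_ e

  union-left : ∀ {G₁} (G₂ : Graph) → LocallyStar G₁ →
               ∀ a → Star 𝒢 (induced (G₁ ⊕ G₂) (N (G₁ ⊕ G₂) (a ↑ˡ n G₂)))
  union-left {G₁} G₂ local a =
    iso (local a) (glue-left-nbhd G₁ G₂ _ a _ (adj-ˡˡ a) (adj-ˡʳ a))
    where open GlueAdj G₁ G₂ (λ _ _ → false)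

  union-local : ∀ {G₁ G₂} → LocallyStar G₁ → LocallyStar G₂ → LocallyStar (G₁ ⊕ G₂)
  union-local {G₁} {G₂} local₁ local₂ v with side (n G₁) (n G₂) v
  ... | left a  = union-left G₂ local₁ a
  ... | right b = nbhd-transport (glue-swap G₁ G₂ λ _ _ → refl) (swap-ˡ (n G₂) (n G₁) b)
                                 (union-left G₁ local₂ b)

  -- The 1-join of (G₁,v₁) and (G₂,v₂) is the glued graph Glued restricted to
  -- Keep, the vertices other than v₁ and v₂; the neighbourhood of w in it is
  -- Glued restricted to JoinNbhd w.
  module OneJoin (G₁ : Graph) (v₁ : V G₁) (G₂ : Graph) (v₂ : V G₂) where
    cross : V G₁ → V G₂ → Bool
    cross x y = adj G₁ v₁ x ∧ adj G₂ v₂ y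

    Glued : Graph
    Glued = glue G₁ G₂ cross

    Keep : V Glued → Bool
    Keep i = not ⌊ i ≟ (v₁ ↑ˡ n G₂) ⌋ ∧ not ⌊ i ≟ (n G₁ ↑ʳ v₂) ⌋

    JoinNbhd : V Glued → V Glued → Bool
    JoinNbhd w x = Keep x ∧ adj Glued w x

    open GlueAdj G₁ G₂ cross

    keep-ˡ : ∀ x → Keep (x ↑ˡ n G₂) ≡ not ⌊ x ≟ v₁ ⌋
    keep-ˡ x = begin
      Keep (x ↑ˡ n G₂)
        ≡⟨ cong₂ (λ p q → not p ∧ not q) (≟-injective _ (↑ˡ-injective (n G₂) _ _) x v₁)
                                          (≟-distinct (↑ˡ≢↑ʳ x v₂)) ⟩
      not ⌊ x ≟ v₁ ⌋ ∧ true
        ≡⟨ ∧-identityʳ _ ⟩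
      not ⌊ x ≟ v₁ ⌋ ∎

    keep-ʳ : ∀ y → Keep (n G₁ ↑ʳ y) ≡ not ⌊ y ≟ v₂ ⌋
    keep-ʳ y = cong₂ (λ p q → not p ∧ not q) (≟-distinct (↑ˡ≢↑ʳ v₁ y ∘ sym))
                                              (≟-injective _ (↑ʳ-injective (n G₁) _ _) y v₂)

    far-≅ : ∀ a → adj G₁ v₁ a ≡ false →
            induced G₁ (N G₁ a) ≅ induced Glued (JoinNbhd (a ↑ˡ n G₂))
    far-≅ a far = glue-left-nbhd G₁ G₂ cross a (JoinNbhd (a ↑ˡ n G₂)) on-left off-right
      where
      keeps-nbhd : ∀ x → not ⌊ x ≟ v₁ ⌋ ∧ adj G₁ a x ≡ adj G₁ a x
      keeps-nbhd x with x ≟ v₁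
      ... | yes refl = sym (trans (adj-sym G₁ a v₁) far)
      ... | no _     = refl

      on-left : ∀ x → JoinNbhd (a ↑ˡ n G₂) (x ↑ˡ n G₂) ≡ adj G₁ a x
      on-left x = trans (cong₂ _∧_ (keep-ˡ x) (adj-ˡˡ a x)) (keeps-nbhd x)

      off-right : ∀ y → JoinNbhd (a ↑ˡ n G₂) (n G₁ ↑ʳ y) ≡ false
      off-right y = begin
        Keep (n G₁ ↑ʳ y) ∧ adj Glued (a ↑ˡ n G₂) (n G₁ ↑ʳ y)
          ≡⟨ cong (Keep (n G₁ ↑ʳ y) ∧_) (trans (adj-ˡʳ a y) (cong (_∧ adj G₂ v₂ y) far)) ⟩
        Keep (n G₁ ↑ʳ y) ∧ false
          ≡⟨ ∧-zeroʳ _ ⟩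
        false ∎

    -- a adjacent to v₁: its neighbourhood is N_{G₁}(a) with v₁ replaced by
    -- N_{G₂}(v₂), i.e. G₂[N(v₂)] substituted for v₁ in G₁[N(a)].
    module Near (a : V G₁) (near : adj G₁ v₁ a ≡ true) where
      K M : Graph
      K = induced G₁ (N G₁ a)
      M = induced G₂ (N G₂ v₂)

      inK : V K → V G₁
      inK = lookup (members G₁ (N G₁ a))

      inM : V M → V G₂
      inM = lookup (members G₂ (N G₂ v₂))

      v₁-in-K : Σ (V K) λ u → inK u ≡ v₁
      v₁-in-K = member-index G₁ (N G₁ a) v₁ (trans (adj-sym G₁ a v₁) near)

      u : V K
      u = proj₁ v₁-in-K

      cross-agrees : ∀ k m → adj K u k ≡ cross (inK k) (inM m)
      cross-agrees k m = begin
        adj G₁ (inK u) (inK k)           ≡⟨ cong (λ z → adj G₁ z (inK k)) (proj₂ v₁-in-K) ⟩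
        adj G₁ v₁ (inK k)                ≡⟨ sym (∧-identityʳ _) ⟩
        adj G₁ v₁ (inK k) ∧ true         ≡⟨ cong (adj G₁ v₁ (inK k) ∧_) (sym (member∈S G₂ (N G₂ v₂) m)) ⟩
        adj G₁ v₁ (inK k) ∧ adj G₂ v₂ (inM m) ∎

      K↪G₁ : Embedding K G₁
      K↪G₁ = members-embedding G₁ (N G₁ a)

      M↪G₂ : Embedding M G₂
      M↪G₂ = members-embedding G₂ (N G₂ v₂)

      place : V (glue K M (λ x _ → adj K u x)) → V Glued
      place = glue-map K↪G₁ M↪G₂ {d = cross} cross-agrees

      place-ˡ : ∀ k → place (k ↑ˡ n M) ≡ inK k ↑ˡ n G₂
      place-ˡ = glue-map-ˡ K↪G₁ M↪G₂ {d = cross} cross-agrees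

      place-ʳ : ∀ m → place (n K ↑ʳ m) ≡ n G₁ ↑ʳ inM m
      place-ʳ = glue-map-ʳ K↪G₁ M↪G₂ {d = cross} cross-agrees

      onto-nbhd : ∀ i → JoinNbhd (a ↑ˡ n G₂) (place i)
                        ≡ not ⌊ i ≟ (u ↑ˡ n M) ⌋
      onto-nbhd i with side (n K) (n M) i
      ... | left k = begin
        JoinNbhd (a ↑ˡ n G₂) (place (k ↑ˡ n M))
          ≡⟨ cong (JoinNbhd (a ↑ˡ n G₂)) (place-ˡ k) ⟩
        Keep (inK k ↑ˡ n G₂) ∧ adj Glued (a ↑ˡ n G₂) (inK k ↑ˡ n G₂)
          ≡⟨ cong₂ _∧_ (keep-ˡ (inK k)) (trans (adj-ˡˡ a (inK k)) (member∈S G₁ (N G₁ a) k)) ⟩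
        not ⌊ inK k ≟ v₁ ⌋ ∧ true
          ≡⟨ ∧-identityʳ _ ⟩
        not ⌊ inK k ≟ v₁ ⌋
          ≡⟨ cong (λ z → not ⌊ inK k ≟ z ⌋) (sym (proj₂ v₁-in-K)) ⟩
        not ⌊ inK k ≟ inK u ⌋
          ≡⟨ cong not (≟-injective inK (members-injective G₁ (N G₁ a)) k u) ⟩
        not ⌊ k ≟ u ⌋
          ≡⟨ cong not (sym (≟-injective _ (↑ˡ-injective (n M) _ _) k u)) ⟩
        not ⌊ k ↑ˡ n M ≟ u ↑ˡ n M ⌋ ∎
      ... | right m = begin
        JoinNbhd (a ↑ˡ n G₂) (place (n K ↑ʳ m))
          ≡⟨ cong (JoinNbhd (a ↑ˡ n G₂)) (place-ʳ m) ⟩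
        Keep (n G₁ ↑ʳ inM m) ∧ adj Glued (a ↑ˡ n G₂) (n G₁ ↑ʳ inM m)
          ≡⟨ cong₂ _∧_ (trans (keep-ʳ (inM m)) (cong not (≟-distinct (neighbour-distinct G₂ v₂~m))))
                       (trans (adj-ˡʳ a (inM m)) (cong₂ _∧_ near v₂~m)) ⟩
        true
          ≡⟨ cong not (sym (≟-distinct (↑ˡ≢↑ʳ u m ∘ sym))) ⟩
        not ⌊ n K ↑ʳ m ≟ u ↑ˡ n M ⌋ ∎
        where
        v₂~m : adj G₂ v₂ (inM m) ≡ true
        v₂~m = member∈S G₂ (N G₂ v₂) m

      covers-nbhd : ∀ z → JoinNbhd (a ↑ˡ n G₂) z ≡ true →
                    Σ (V (glue K M (λ x _ → adj K u x))) λ i → place i ≡ z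
      covers-nbhd z in-nbhd with side (n G₁) (n G₂) z
      ... | left x with member-index G₁ (N G₁ a) x
                          (trans (sym (adj-ˡˡ a x)) (∧-conicalʳ _ _ in-nbhd))
      ...   | k , k↦x = k ↑ˡ n M , trans (place-ˡ k) (cong (_↑ˡ n G₂) k↦x)
      covers-nbhd z in-nbhd | right y with member-index G₂ (N G₂ v₂) y
                          (∧-conicalʳ _ _ (trans (sym (adj-ˡʳ a y)) (∧-conicalʳ _ _ in-nbhd)))
      ...   | m , m↦y = n K ↑ʳ m , trans (place-ʳ m) (cong (n G₁ ↑ʳ_) m↦y)

      near-≅ : substitute K u M ≅ induced Glued (JoinNbhd (a ↑ˡ n G₂))
      near-≅ = induced-≅ (glue-embedding K↪G₁ M↪G₂ {d = cross} cross-agrees) onto-nbhd covers-nbhd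

    left-star : LocallyStar G₁ → LocallyStar G₂ →
                ∀ a → Star 𝒢 (induced Glued (JoinNbhd (a ↑ˡ n G₂)))
    left-star local₁ local₂ a with adj G₁ v₁ a in v₁~a
    ... | false = iso (local₁ a) (far-≅ a v₁~a)
    ... | true  = iso (star-subst (local₁ a) (local₂ v₂) (Near.u a v₁~a)) (Near.near-≅ a v₁~a)

  -- Exchanging the roles of (G₁,v₁) and (G₂,v₂) identifies the neighbourhoods
  -- of the right-hand vertices with left-hand ones of the mirrored join.
  module JoinSymmetry (G₁ : Graph) (v₁ : V G₁) (G₂ : Graph) (v₂ : V G₂) where
    open OneJoin G₁ v₁ G₂ v₂
    module Mirror = OneJoin G₂ v₂ G₁ v₁

    mirror : Mirror.Glued ≅ Glued
    mirror = glue-swap G₁ G₂ (λ y x → ∧-comm (adj G₂ v₂ y) (adj G₁ v₁ x))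

    open _≅_ mirror

    keep-mirror : ∀ x → Keep (to x) ≡ Mirror.Keep x
    keep-mirror x = begin
      not ⌊ to x ≟ v₁ ↑ˡ n G₂ ⌋ ∧ not ⌊ to x ≟ n G₁ ↑ʳ v₂ ⌋
        ≡⟨ cong₂ (λ p q → not ⌊ to x ≟ p ⌋ ∧ not ⌊ to x ≟ q ⌋)
                 (sym (swap-ʳ (n G₂) (n G₁) v₁)) (sym (swap-ˡ (n G₂) (n G₁) v₂)) ⟩
      not ⌊ to x ≟ to (n G₂ ↑ʳ v₁) ⌋ ∧ not ⌊ to x ≟ to (v₂ ↑ˡ n G₁) ⌋
        ≡⟨ cong₂ (λ p q → not p ∧ not q) (≟-injective to to-injective x _)
                                          (≟-injective to to-injective x _) ⟩
      not ⌊ x ≟ n G₂ ↑ʳ v₁ ⌋ ∧ not ⌊ x ≟ v₂ ↑ˡ n G₁ ⌋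
        ≡⟨ ∧-comm (not ⌊ x ≟ n G₂ ↑ʳ v₁ ⌋) (not ⌊ x ≟ v₂ ↑ˡ n G₁ ⌋) ⟩
      Mirror.Keep x ∎
      where to-injective = Embedding.injective (iso-embedding mirror)

    right-≅ : ∀ b → induced Mirror.Glued (Mirror.JoinNbhd (b ↑ˡ n G₁))
                      ≅ induced Glued (JoinNbhd (n G₁ ↑ʳ b))
    right-≅ b = induced-≅ (iso-embedding mirror) onto (λ y _ → from y , to-from y)
      where
      onto : ∀ x → JoinNbhd (n G₁ ↑ʳ b) (to x) ≡ Mirror.JoinNbhd (b ↑ˡ n G₁) x
      onto x = cong₂ _∧_ (keep-mirror x)
        (trans (cong (λ w → adj Glued w (to x)) (sym (swap-ˡ (n G₂) (n G₁) b)))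
               (sym (adj-pres (b ↑ˡ n G₁) x)))

  join-local : ∀ {G₁ G₂} (v₁ : V G₁) (v₂ : V G₂) → LocallyStar G₁ → LocallyStar G₂ →
               LocallyStar (oneJoin G₁ v₁ G₂ v₂)
  join-local {G₁} {G₂} v₁ v₂ local₁ local₂ v =
    iso (by-side (side (n G₁) (n G₂) w)) (induced-nbhd-≅ Glued Keep v)
    where
    open OneJoin G₁ v₁ G₂ v₂
    w = lookup (members Glued Keep) v

    by-side : ∀ {w} → Side (n G₁) (n G₂) w → Star 𝒢 (induced Glued (JoinNbhd w))
    by-side (left a)  = left-star local₁ local₂ a
    by-side (right b) = iso (OneJoin.left-star G₂ v₂ G₁ v₁ local₂ local₁ b)
                            (JoinSymmetry.right-≅ G₁ v₁ G₂ v₂ b)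

lemma3p2 : (𝒢 : Class) → Hereditary 𝒢 →
           (G : Graph) → Amp 𝒢 G → (v : V G) →
           Star 𝒢 (induced G (N G v))
lemma3p2 𝒢 hereditary = local
  where
  open Closure 𝒢

  local : ∀ G → Amp 𝒢 G → LocallyStar G
  local _ (base g)                   = base-local hereditary g
  local _ (iso g e)                  = iso-local (local _ g) e
  local _ (union g h)                = union-local (local _ g) (local _ h)
  local _ (join g h _ _ v₁ v₂)          = join-local v₁ v₂ (local _ g) (local _ h)
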